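{- Let $G=([n],E)$ be a natural unit interval graph. The map $T\mapsto\mathrm{list}(T)$ is a bijection from the set of decreasing subtrees of $G$ to the set of tree lists of $G$.
   Context: A graph $G=([n],E)$ is a natural unit interval graph if for all $1\le i<j<k\le n$, $\{i,k\}\in E$ implies $\{i,j\}\in E$ and $\{j,k\}\in E$. A decreasing subtree of $G$ is a subgraph $T$ of $G$ which is a tree (with nonempty vertex set) such that every vertex of $T$ other than the largest vertex of $T$ has exactly one neighbour in $T$ larger than itself. $\mathrm{list}(T)$ is the permutation (word) of $V(T)$ obtained by reading first the smallest vertex of $T$, and at each subsequent step reading the smallest unread vertex of $T$ adjacent in $T$ to an already read vertex. For a nonempty subset $A\subseteq[n]$, a tree list of $G$ (on $A$) is a permutation $\sigma=\sigma_1\cdots\sigma_h$ of $A$ with $\sigma_1=\min A$ such that: (descent condition) whenever $\sigma_i>\sigma_{i+1}$ we have $\{\sigma_{i+1},\sigma_i\}\in E$; and (left-to-right maxima condition) if $a_1<\dots<a_s$ are the left-to-right maxima of $\sigma$ (entries $\sigma_j$ with $\sigma_j>\sigma_i$ for all $i<j$), then $\{a_i,a_{i+1}\}\in E$ for all $1\le i\le s-1$. The tree lists of $G$ are the tree lists on all nonempty subsets $A$. -}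

module Defs where

open import Data.Bool using (Bool; true; false; _∧_; _∨_; not; if_then_else_)
open import Data.Nat using (ℕ; zero; suc; _<ᵇ_; _≤_)
open import Data.Fin using (Fin; toℕ; _<_; _≟_)
open import Data.Fin.Subset using (Subset; _∈_)
open import Data.Vec using (Vec; lookup)
open import Data.List using (List; []; _∷_; _++_; [_]; allFin; length)
open import Data.Bool.ListAction using (any)
open import Data.List.Relation.Unary.All using (All)
open import Data.List.Relation.Unary.Linked using (Linked)
open import Data.List.Relation.Unary.Unique.Propositional using (Unique)
open import Data.Maybe using (Maybe; just; nothing)
open import Data.Product using (Σ; ∃; _×_)
open import Data.Empty using (⊥)
open import Relation.Nullary using (¬_; does)
open import Relation.Binary.PropositionalEquality using (_≡_)

-- Graphs on the vertex set [n], encoded as Fin n (vertex i+1 ↦ i; order preserved).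
-- A graph is given by its adjacency matrix of booleans.

Graph : ℕ → Set
Graph n = Vec (Vec Bool n) n

adj : ∀ {n} → Graph n → Fin n → Fin n → Set
adj G i j = lookup (lookup G i) j ≡ true

adjᵇ : ∀ {n} → Graph n → Fin n → Fin n → Bool
adjᵇ G i j = lookup (lookup G i) j

IsSimple : ∀ {n} → Graph n → Set
IsSimple G = (∀ i j → adj G i j → adj G j i) × (∀ i → ¬ adj G i i)

IsNUI : ∀ {n} → Graph n → Set
IsNUI G = ∀ i j k → i < j → j < k → adj G i k → adj G i j × adj G j k

record Subgraph (n : ℕ) : Set where
  constructor mkSub
  field
    verts : Subset n
    edges : Graph n

open Subgraph public

edge : ∀ {n} → Subgraph n → Fin n → Fin n → Set
edge T = adj (edges T)

IsSubgraphOf : ∀ {n} → Graph n → Subgraph n → Set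
IsSubgraphOf G T =
  (∀ u v → edge T u v → adj G u v) ×
  (∀ u v → edge T u v → u ∈ verts T) ×
  (∀ u v → edge T u v → edge T v u)

data Walk {n} (T : Subgraph n) : Fin n → Fin n → Set where
  here : ∀ {u} → u ∈ verts T → Walk T u u
  step : ∀ {u w v} → edge T u w → Walk T w v → Walk T u v

Connected : ∀ {n} → Subgraph n → Set
Connected T = ∀ u v → u ∈ verts T → v ∈ verts T → Walk T u v

HasCycle : ∀ {n} → Subgraph n → Set
HasCycle {n} T = Σ (Fin n) λ x → Σ (List (Fin n)) λ ys →
  (2 ≤ length ys) × Unique (x ∷ ys) × Linked (edge T) (x ∷ ys ++ [ x ])

IsTree : ∀ {n} → Subgraph n → Set
IsTree T = (∃ λ v → v ∈ verts T) × Connected T × ¬ HasCycle T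

IsDecreasing : ∀ {n} → Subgraph n → Set
IsDecreasing {n} T = ∀ v → v ∈ verts T → (∃ λ w → w ∈ verts T × v < w) →
  Σ (Fin n) λ u → edge T v u × v < u × (∀ w → edge T v w → v < w → w ≡ u)

IsDecSubtree : ∀ {n} → Graph n → Subgraph n → Set
IsDecSubtree G T = IsSubgraphOf G T × IsTree T × IsDecreasing T

firstWith : ∀ {n} → (Fin n → Bool) → List (Fin n) → Maybe (Fin n)
firstWith p [] = nothing
firstWith p (x ∷ xs) = if p x then just x else firstWith p xs

elemᵇ : ∀ {n} → Fin n → List (Fin n) → Bool
elemᵇ v = any (λ r → does (r ≟ v))

nextVertex : ∀ {n} → Subgraph n → List (Fin n) → Maybe (Fin n)
nextVertex {n} T read = firstWith
  (λ v → lookup (verts T) v ∧ not (elemᵇ v read) ∧ any (λ r → adjᵇ (edges T) r v) read)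
  (allFin n)

grow : ∀ {n} → Subgraph n → ℕ → List (Fin n) → List (Fin n)
grow T zero read = read
grow T (suc k) read with nextVertex T read
... | nothing = read
... | just v = grow T k (read ++ [ v ])

listT : ∀ {n} → Subgraph n → List (Fin n)
listT {n} T with firstWith (lookup (verts T)) (allFin n)
... | nothing = []
... | just v = grow T n [ v ]

ltrFrom : ∀ {n} → Fin n → List (Fin n) → List (Fin n)
ltrFrom m [] = []
ltrFrom m (x ∷ xs) = if toℕ m <ᵇ toℕ x then x ∷ ltrFrom x xs else ltrFrom m xs

ltrMaxima : ∀ {n} → List (Fin n) → List (Fin n)
ltrMaxima [] = []
ltrMaxima (x ∷ xs) = x ∷ ltrFrom x xs

-- tree list on A = the set of entries of σ (σ is a permutation of A: no repeats)
IsTreeList : ∀ {n} → Graph n → List (Fin n) → Set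
IsTreeList G [] = ⊥
IsTreeList G (x ∷ xs) =
  All (x <_) xs ×
  Unique (x ∷ xs) ×
  Linked (λ a b → b < a → adj G b a) (x ∷ xs) ×
  Linked (adj G) (ltrMaxima (x ∷ xs))

-- Read a word σ = σ₁⋯σₕ from left to right and join each later entry to its parent:
-- the nearest earlier entry above it, or, for a new left-to-right maximum, the previous
-- maximum.  This gives a tree whose vertices all have exactly one larger neighbour, except
-- the maximum, and reading it greedily (least unread neighbour first) returns σ.  For a
-- tree list of a natural unit interval graph G every such parent edge is an edge of G: a
-- descent σᵢ > σᵢ₊₁ is an edge of G, and the unit interval property carries it back to
-- the parent; a new maximum is adjacent to the previous one by the maxima condition.
-- Conversely, when list(T) of a decreasing subtree T reads its next vertex v, v is joined
-- to the read vertices by a single edge, and it leads to the parent of v; the descent and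
-- maxima conditions follow.  So T ↦ list(T) and σ ↦ (tree of σ) are mutually inverse.

module Submission where

open import Defs
open import Data.Bool using (Bool; true; false; _∧_; _∨_; not; if_then_else_; T)
open import Data.Bool.ListAction using (any)
open import Data.Bool.Properties using (∨-zeroʳ)
open import Data.Empty using (⊥-elim)
open import Data.Fin as F using (Fin; toℕ; _≟_; _<_; _≤_)
open import Data.Fin.Properties
  using (pigeonhole; ≤-refl; ≤-reflexive; ≤-antisym; <-cmp; <-trans; <-asym; <-irrefl; ≤∧≢⇒<)
open import Data.Fin.Subset using (Subset) renaming (_∈_ to _∈ˢ_)
open import Data.List as L using (List; []; _∷_; _++_; [_]; allFin; length; tabulate)
open import Data.List.Membership.Propositional using (_∈_; _∉_)
open import Data.List.Membership.Propositional.Properties using (∈-++⁺ˡ; ∈-++⁺ʳ; ∈-++⁻; ∈-lookup)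
open import Data.List.Properties using (++-assoc; ++-identityʳ)
open import Data.List.Relation.Binary.Subset.Propositional using (_⊆_)
open import Data.List.Relation.Unary.All as All using (All; []; _∷_)
open import Data.List.Relation.Unary.All.Properties using (++⁺)
open import Data.List.Relation.Unary.AllPairs using ([]; _∷_)
open import Data.List.Relation.Unary.Any using (here; there)
open import Data.List.Relation.Unary.Linked using (Linked; []; [-]; _∷_; head; tail)
open import Data.List.Relation.Unary.Linked.Properties using (Linked⇒All)
open import Data.List.Relation.Unary.Unique.Propositional using (Unique)
open import Data.Maybe using (just; nothing)
open import Data.Nat as ℕ using (ℕ; zero; suc; _<ᵇ_; s≤s)
import Data.Nat.Properties as ℕ
open import Data.Product using (Σ; _×_; _,_; proj₁; proj₂)
open import Data.Product.Properties using (≡-dec)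
open import Data.Sum using (_⊎_; inj₁; inj₂)
open import Data.Unit using (⊤; tt)
open import Data.Vec as V using (Vec; lookup)
open import Data.Vec.Properties using ([]=⇒lookup; lookup⇒[]=; lookup∘tabulate; tabulate∘lookup; tabulate-cong)
open import Function using (flip)
open import Function.Bundles using (_⇔_; mk⇔; Equivalence)
open import Function.Properties.Equivalence using () renaming (sym to ⇔-sym; trans to ⇔-trans)
open import Relation.Binary.Definitions using (tri<; tri≈; tri>; Transitive; Irreflexive)
open import Relation.Binary.PropositionalEquality using (_≡_; _≢_; refl; sym; trans; cong; cong₂; subst)
open import Relation.Nullary using (¬_; does; yes; no)
open import Relation.Nullary.Decidable using (dec-true)

<ᵇ-cases : ∀ m k → ((m <ᵇ k) ≡ true × m ℕ.< k) ⊎ ((m <ᵇ k) ≡ false × ¬ m ℕ.< k)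
<ᵇ-cases m k with m <ᵇ k in eq
... | true  = inj₁ (refl , ℕ.<ᵇ⇒< m k (subst T (sym eq) tt))
... | false = inj₂ (refl , λ m<k → subst T eq (ℕ.<⇒<ᵇ m<k))

-- Written with _<ᵇ_ so that it unfolds in step with ltrFrom.
_⊔_ : ∀ {n} → Fin n → Fin n → Fin n
i ⊔ j = if toℕ i <ᵇ toℕ j then j else i

module _ {n : ℕ} where

  i<j⇒i⊔j≡j : (i j : Fin n) → i < j → i ⊔ j ≡ j
  i<j⇒i⊔j≡j i j i<j with <ᵇ-cases (toℕ i) (toℕ j)
  ... | inj₁ (e , _) rewrite e = refl
  ... | inj₂ (_ , i≮j) = ⊥-elim (i≮j i<j)

  i≮j⇒i⊔j≡i : (i j : Fin n) → ¬ i < j → i ⊔ j ≡ i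
  i≮j⇒i⊔j≡i i j i≮j with <ᵇ-cases (toℕ i) (toℕ j)
  ... | inj₁ (_ , i<j) = ⊥-elim (i≮j i<j)
  ... | inj₂ (e , _) rewrite e = refl

  ⊔-sel : (i j : Fin n) → i ⊔ j ≡ i ⊎ i ⊔ j ≡ j
  ⊔-sel i j with toℕ i <ᵇ toℕ j
  ... | true  = inj₂ refl
  ... | false = inj₁ refl

  i≤i⊔j : (i j : Fin n) → i ≤ i ⊔ j
  i≤i⊔j i j with <ᵇ-cases (toℕ i) (toℕ j)
  ... | inj₁ (e , i<j) rewrite e = ℕ.<⇒≤ i<j
  ... | inj₂ (e , _) rewrite e = ≤-refl

  j≤i⊔j : (i j : Fin n) → j ≤ i ⊔ j
  j≤i⊔j i j with <ᵇ-cases (toℕ i) (toℕ j)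
  ... | inj₁ (e , _) rewrite e = ≤-refl
  ... | inj₂ (e , i≮j) rewrite e = ℕ.≮⇒≥ i≮j

  ⊔-lub : (i j k : Fin n) → i ≤ k → j ≤ k → i ⊔ j ≤ k
  ⊔-lub i j k i≤k j≤k with ⊔-sel i j
  ... | inj₁ e rewrite e = i≤k
  ... | inj₂ e rewrite e = j≤k

  ⊔-∈ : ∀ i j {xs : List (Fin n)} → i ∈ xs → j ∈ xs → i ⊔ j ∈ xs
  ⊔-∈ i j i∈ j∈ with ⊔-sel i j
  ... | inj₁ e rewrite e = i∈
  ... | inj₂ e rewrite e = j∈

true≢false : true ≢ false
true≢false ()

firstWith-tabulate-just : ∀ {n} m (g : Fin m → Fin n) (p : Fin n → Bool) v →
  firstWith p (tabulate g) ≡ just v →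
  Σ (Fin m) λ i → g i ≡ v × p v ≡ true × (∀ j → toℕ j ℕ.< toℕ i → p (g j) ≡ false)
firstWith-tabulate-just (suc m) g p v eq with p (g F.zero) in e
firstWith-tabulate-just (suc m) g p v refl | true = F.zero , refl , e , λ _ ()
... | false with firstWith-tabulate-just m (λ i → g (F.suc i)) p v eq
... | i , gi≡v , pv , earlier = F.suc i , gi≡v , pv , earlier′
  where
  earlier′ : ∀ j → toℕ j ℕ.< toℕ (F.suc i) → p (g j) ≡ false
  earlier′ F.zero _ = e
  earlier′ (F.suc j) (s≤s j<i) = earlier j j<i

firstWith-tabulate-nothing : ∀ {n} m (g : Fin m → Fin n) (p : Fin n → Bool) →
  firstWith p (tabulate g) ≡ nothing → ∀ j → p (g j) ≡ false
firstWith-tabulate-nothing (suc m) g p eq j with p (g F.zero) in e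
firstWith-tabulate-nothing (suc m) g p () j | true
firstWith-tabulate-nothing (suc m) g p eq F.zero | false = e
firstWith-tabulate-nothing (suc m) g p eq (F.suc j) | false =
  firstWith-tabulate-nothing m (λ i → g (F.suc i)) p eq j

module _ {n : ℕ} (p : Fin n → Bool) where

  firstWith-just⇒least : ∀ v → firstWith p (allFin n) ≡ just v →
    p v ≡ true × (∀ w → p w ≡ true → v ≤ w)
  firstWith-just⇒least v eq with firstWith-tabulate-just n (λ i → i) p v eq
  ... | .v , refl , pv , earlier = pv , least
    where
    least : ∀ w → p w ≡ true → v ≤ w
    least w pw with <-cmp w v
    ... | tri< w<v _ _ = ⊥-elim (true≢false (trans (sym pw) (earlier w w<v)))
    ... | tri≈ _ w≡v _ = ≤-reflexive (sym w≡v)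
    ... | tri> _ _ v<w = ℕ.<⇒≤ v<w

  firstWith-nothing⇒none : firstWith p (allFin n) ≡ nothing → ∀ w → p w ≡ false
  firstWith-nothing⇒none = firstWith-tabulate-nothing n (λ i → i) p

  least⇒firstWith-just : ∀ v → p v ≡ true → (∀ w → p w ≡ true → v ≤ w) →
    firstWith p (allFin n) ≡ just v
  least⇒firstWith-just v pv least with firstWith p (allFin n) in eq
  ... | nothing = ⊥-elim (true≢false (trans (sym pv) (firstWith-nothing⇒none eq v)))
  ... | just v′ with firstWith-just⇒least v′ eq
  ... | pv′ , least′ = cong just (≤-antisym (least′ v pv) (least v′ pv′))

any≡true⇒∃ : ∀ {A : Set} (f : A → Bool) xs → any f xs ≡ true → Σ A λ r → r ∈ xs × f r ≡ true
any≡true⇒∃ f (x ∷ xs) eq with f x in e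
... | true = x , here refl , e
... | false with any≡true⇒∃ f xs eq
... | r , r∈ , fr = r , there r∈ , fr

∈⇒any≡true : ∀ {A : Set} (f : A → Bool) {xs r} → r ∈ xs → f r ≡ true → any f xs ≡ true
∈⇒any≡true f (here refl) fr rewrite fr = refl
∈⇒any≡true f {x ∷ _} (there r∈) fr with f x
... | true  = refl
... | false = ∈⇒any≡true f r∈ fr

module _ {n : ℕ} where

  elemᵇ≡true⇒∈ : ∀ (v : Fin n) xs → elemᵇ v xs ≡ true → v ∈ xs
  elemᵇ≡true⇒∈ v xs eq with any≡true⇒∃ (λ r → does (r ≟ v)) xs eq
  ... | r , r∈ , e with r ≟ v
  ... | yes refl = r∈

  ∈⇒elemᵇ≡true : ∀ (v : Fin n) xs → v ∈ xs → elemᵇ v xs ≡ true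
  ∈⇒elemᵇ≡true v xs v∈ = ∈⇒any≡true (λ r → does (r ≟ v)) v∈ (v≟v v)
    where
    v≟v : ∀ v → does (v ≟ v) ≡ true
    v≟v v with v ≟ v
    ... | yes _ = refl
    ... | no v≢v = ⊥-elim (v≢v refl)

  ∈ˢ⇒lookup : (p : Subset n) {v : Fin n} → v ∈ˢ p → lookup p v ≡ true
  ∈ˢ⇒lookup p = []=⇒lookup

  lookup⇒∈ˢ : (p : Subset n) (v : Fin n) → lookup p v ≡ true → v ∈ˢ p
  lookup⇒∈ˢ p v = lookup⇒[]= v p

  Frontier : Subgraph n → List (Fin n) → Fin n → Set
  Frontier T R w = (w ∈ˢ verts T) × (w ∉ R) × Σ (Fin n) λ r → r ∈ R × edge T r w

  Frontier-cong : ∀ T {R R′} → R ⊆ R′ → R′ ⊆ R → ∀ {w} → Frontier T R w → Frontier T R′ w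
  Frontier-cong T R⊆R′ R′⊆R (w∈T , w∉R , r , r∈R , e) =
    w∈T , (λ w∈R′ → w∉R (R′⊆R w∈R′)) , r , R⊆R′ r∈R , e

  private
    frontierᵇ : Subgraph n → List (Fin n) → Fin n → Bool
    frontierᵇ T R v = lookup (verts T) v ∧ not (elemᵇ v R) ∧ any (λ r → adjᵇ (edges T) r v) R

    frontierᵇ⇒Frontier : ∀ T R w → frontierᵇ T R w ≡ true → Frontier T R w
    frontierᵇ⇒Frontier T R w eq
      with lookup (verts T) w in e₁ | elemᵇ w R in e₂ | any (λ r → adjᵇ (edges T) r w) R in e₃
    ... | true | false | true =
      lookup⇒∈ˢ (verts T) w e₁ , (λ w∈ → true≢false (trans (sym (∈⇒elemᵇ≡true w R w∈)) e₂)) ,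
      any≡true⇒∃ _ R e₃

    Frontier⇒frontierᵇ : ∀ T R w → Frontier T R w → frontierᵇ T R w ≡ true
    Frontier⇒frontierᵇ T R w (w∈T , w∉R , r , r∈R , e)
      with lookup (verts T) w in e₁ | elemᵇ w R in e₂ | any (λ r → adjᵇ (edges T) r w) R in e₃
    ... | true  | false | true  = refl
    ... | false | _     | _     = ⊥-elim (true≢false (trans (sym (∈ˢ⇒lookup (verts T) w∈T)) e₁))
    ... | true  | true  | _     = ⊥-elim (w∉R (elemᵇ≡true⇒∈ w R e₂))
    ... | true  | false | false =
      ⊥-elim (true≢false (trans (sym (∈⇒any≡true (λ r → adjᵇ (edges T) r w) r∈R e)) e₃))

  nextVertex≡just⇒least : ∀ T R v → nextVertex T R ≡ just v →
    Frontier T R v × (∀ w → Frontier T R w → v ≤ w)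
  nextVertex≡just⇒least T R v eq with firstWith-just⇒least (frontierᵇ T R) v eq
  ... | fv , least = frontierᵇ⇒Frontier T R v fv , λ w fw → least w (Frontier⇒frontierᵇ T R w fw)

  nextVertex≡nothing⇒empty : ∀ T R → nextVertex T R ≡ nothing → ∀ w → ¬ Frontier T R w
  nextVertex≡nothing⇒empty T R eq w fw =
    true≢false (trans (sym (Frontier⇒frontierᵇ T R w fw)) (firstWith-nothing⇒none (frontierᵇ T R) eq w))

  least⇒nextVertex≡just : ∀ T R v → Frontier T R v → (∀ w → Frontier T R w → v ≤ w) →
    nextVertex T R ≡ just v
  least⇒nextVertex≡just T R v fv least =
    least⇒firstWith-just (frontierᵇ T R) v (Frontier⇒frontierᵇ T R v fv)
      (λ w e → least w (frontierᵇ⇒Frontier T R w e))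

-- u ∷ Q is the list read so far, most recent first.
data GreedyRun {n} (T : Subgraph n) : Fin n → List (Fin n) → List (Fin n) → Set where
  done : ∀ {u Q} → (∀ w → ¬ Frontier T (u ∷ Q) w) → GreedyRun T u Q []
  next : ∀ {u Q v S} → Frontier T (u ∷ Q) v → (∀ w → Frontier T (u ∷ Q) w → v ≤ w) →
         GreedyRun T v (u ∷ Q) S → GreedyRun T u Q (v ∷ S)

module _ {n : ℕ} where

  private
    snoc-⊆ : ∀ {R : List (Fin n)} {u Q} v → R ⊆ u ∷ Q → R ++ [ v ] ⊆ v ∷ u ∷ Q
    snoc-⊆ {R} v R⊆ z∈ with ∈-++⁻ R z∈
    ... | inj₁ z∈R = there (R⊆ z∈R)
    ... | inj₂ (here refl) = here refl

    snoc-⊇ : ∀ {R : List (Fin n)} {u Q} v → u ∷ Q ⊆ R → v ∷ u ∷ Q ⊆ R ++ [ v ]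
    snoc-⊇ {R} v ⊆R (here refl) = ∈-++⁺ʳ R (here refl)
    snoc-⊇ {R} v ⊆R (there z∈) = ∈-++⁺ˡ (⊆R z∈)

  grow-run : ∀ T {u Q S} → GreedyRun T u Q S → ∀ k R → R ⊆ u ∷ Q → u ∷ Q ⊆ R →
    length S ℕ.≤ k → grow T k R ≡ R ++ S
  grow-run T (done empty) zero R _ _ _ = sym (++-identityʳ R)
  grow-run T (done empty) (suc k) R R⊆ ⊆R _ with nextVertex T R in e
  ... | nothing = sym (++-identityʳ R)
  ... | just v = ⊥-elim (empty v (Frontier-cong T R⊆ ⊆R (proj₁ (nextVertex≡just⇒least T R v e))))
  grow-run T {S = v ∷ S} (next fv least run) (suc k) R R⊆ ⊆R (s≤s len)
    rewrite least⇒nextVertex≡just T R v (Frontier-cong T ⊆R R⊆ fv)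
              (λ w fw → least w (Frontier-cong T R⊆ ⊆R fw)) =
    trans (grow-run T run k (R ++ [ v ]) (snoc-⊆ v R⊆) (snoc-⊇ v ⊆R) len) (++-assoc R [ v ] S)

  length≤n : (xs : List (Fin n)) → Unique xs → length xs ℕ.≤ n
  length≤n xs uniq with length xs ℕ.≤? n
  ... | yes len≤n = len≤n
  ... | no len≰n with pigeonhole (ℕ.≰⇒> len≰n) (L.lookup xs)
  ... | i , j , i<j , eq = ⊥-elim (distinct uniq i j i<j eq)
    where
    distinct : ∀ {ys : List (Fin n)} → Unique ys → ∀ i j → i < j → L.lookup ys i ≢ L.lookup ys j
    distinct (y∉ ∷ _) F.zero (F.suc j) _ = All.lookup y∉ (∈-lookup j)
    distinct (_ ∷ uniq) (F.suc i) (F.suc j) (s≤s i<j) = distinct uniq i j i<j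

  grow⇒run : ∀ T k R u Q → R ⊆ u ∷ Q → u ∷ Q ⊆ R → Unique (u ∷ Q) →
    suc n ℕ.≤ length (u ∷ Q) ℕ.+ k →
    Σ (List (Fin n)) λ S → grow T k R ≡ R ++ S × GreedyRun T u Q S
  grow⇒run T zero R u Q _ _ uniq len =
    ⊥-elim (ℕ.<⇒≱ (subst (suc n ℕ.≤_) (ℕ.+-identityʳ _) len) (length≤n (u ∷ Q) uniq))
  grow⇒run T (suc k) R u Q R⊆ ⊆R uniq len with nextVertex T R in e
  ... | nothing = [] , sym (++-identityʳ R) ,
        done (λ w fw → nextVertex≡nothing⇒empty T R e w (Frontier-cong T ⊆R R⊆ fw))
  ... | just v with nextVertex≡just⇒least T R v e
  ... | fv@(_ , v∉R , _) , least
    with grow⇒run T k (R ++ [ v ]) v (u ∷ Q) (snoc-⊆ v R⊆) (snoc-⊇ v ⊆R)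
           (All.tabulate (λ z∈ v≡z → v∉R (⊆R (subst (_∈ u ∷ Q) (sym v≡z) z∈))) ∷ uniq)
           (subst (suc n ℕ.≤_) (ℕ.+-suc (length (u ∷ Q)) k) len)
  ... | S , eq , run = v ∷ S , trans eq (++-assoc R [ v ] S) ,
        next (Frontier-cong T R⊆ ⊆R fv) (λ w fw → least w (Frontier-cong T ⊆R R⊆ fw)) run

module _ {n : ℕ} where

  -- parent w (u ∷ Q), for a prefix read in reverse order u ∷ Q, is its most
  -- recent entry above w, or its maximum if there is none.
  parent : Fin n → List (Fin n) → Fin n
  parent w [] = w
  parent w (u ∷ []) = u
  parent w (u ∷ q ∷ Q) = if toℕ w <ᵇ toℕ u then u else parent w (q ∷ Q) ⊔ u

  maximum : Fin n → List (Fin n) → Fin n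
  maximum u [] = u
  maximum u (q ∷ Q) = maximum q Q ⊔ u

  parentEdges : List (Fin n) → List (Fin n) → List (Fin n × Fin n)
  parentEdges L [] = []
  parentEdges L (v ∷ S) = (v , parent v L) ∷ parentEdges (v ∷ L) S

  treeEdges : List (Fin n) → List (Fin n × Fin n)
  treeEdges [] = []
  treeEdges (x ∷ xs) = parentEdges [ x ] xs

  TreeEdge : List (Fin n) → Fin n → Fin n → Set
  TreeEdge σ a b = ((a , b) ∈ treeEdges σ) ⊎ ((b , a) ∈ treeEdges σ)

  TreeEdge-sym : ∀ {σ a b} → TreeEdge σ a b → TreeEdge σ b a
  TreeEdge-sym (inj₁ ab∈) = inj₂ ab∈
  TreeEdge-sym (inj₂ ba∈) = inj₁ ba∈

  parent∈ : ∀ w u Q → parent w (u ∷ Q) ∈ u ∷ Q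
  parent∈ w u [] = here refl
  parent∈ w u (q ∷ Q) with toℕ w <ᵇ toℕ u
  ... | true  = here refl
  ... | false = ⊔-∈ (parent w (q ∷ Q)) u (there (parent∈ w q Q)) (here refl)

  maximum∈ : ∀ u Q → maximum u Q ∈ u ∷ Q
  maximum∈ u [] = here refl
  maximum∈ u (q ∷ Q) = ⊔-∈ (maximum q Q) u (there (maximum∈ q Q)) (here refl)

  ≤maximum : ∀ u Q {y} → y ∈ u ∷ Q → y ≤ maximum u Q
  ≤maximum u [] (here refl) = ≤-refl
  ≤maximum u (q ∷ Q) (here refl) = j≤i⊔j (maximum q Q) u
  ≤maximum u (q ∷ Q) (there y∈) = ℕ.≤-trans (≤maximum q Q y∈) (i≤i⊔j (maximum q Q) u)

  parent-cases : ∀ w u Q → w < parent w (u ∷ Q) ⊎ (parent w (u ∷ Q) ≡ maximum u Q × maximum u Q ≤ w)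
  parent-cases w u [] with <ᵇ-cases (toℕ w) (toℕ u)
  ... | inj₁ (_ , w<u) = inj₁ w<u
  ... | inj₂ (_ , w≮u) = inj₂ (refl , ℕ.≮⇒≥ w≮u)
  parent-cases w u (q ∷ Q) with <ᵇ-cases (toℕ w) (toℕ u)
  ... | inj₁ (e , w<u) rewrite e = inj₁ w<u
  ... | inj₂ (e , w≮u) rewrite e with parent-cases w q Q
  ...   | inj₁ w<p = inj₁ (subst (w <_) (sym (i≮j⇒i⊔j≡i (parent w (q ∷ Q)) u
                      (λ p<u → w≮u (<-trans w<p p<u)))) w<p)
  ...   | inj₂ (p≡max , max≤w) rewrite p≡max =
          inj₂ (refl , ⊔-lub (maximum q Q) u w max≤w (ℕ.≮⇒≥ w≮u))

  module _ {R : Fin n → Fin n → Set} {m v : Fin n} {S : List (Fin n)} where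

    ltrFrom-∷⁻ : Linked R (m ∷ ltrFrom m (v ∷ S)) → Linked R (m ⊔ v ∷ ltrFrom (m ⊔ v) S)
    ltrFrom-∷⁻ linked with <ᵇ-cases (toℕ m) (toℕ v)
    ... | inj₁ (e , _) rewrite e with linked
    ...   | _ ∷ rest = rest
    ltrFrom-∷⁻ linked | inj₂ (e , _) rewrite e = linked

    ltrFrom-∷⁺ : (m < v → R m v) → Linked R (m ⊔ v ∷ ltrFrom (m ⊔ v) S) →
                 Linked R (m ∷ ltrFrom m (v ∷ S))
    ltrFrom-∷⁺ new linked with <ᵇ-cases (toℕ m) (toℕ v)
    ... | inj₁ (e , m<v) rewrite e = new m<v ∷ linked
    ... | inj₂ (e , _) rewrite e = linked

    ltrFrom-head : m < v → Linked R (m ∷ ltrFrom m (v ∷ S)) → R m v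
    ltrFrom-head m<v linked with <ᵇ-cases (toℕ m) (toℕ v)
    ... | inj₁ (e , _) rewrite e with linked
    ...   | Rmv ∷ _ = Rmv
    ltrFrom-head m<v linked | inj₂ (_ , m≮v) = ⊥-elim (m≮v m<v)

  data LatestAbove (w r : Fin n) : List (Fin n) → Set where
    latest : ∀ {Q} → w < r → LatestAbove w r (r ∷ Q)
    below  : ∀ {u Q} → u < w → LatestAbove w r Q → LatestAbove w r (u ∷ Q)

  LatestAbove⇒< : ∀ {w r L} → LatestAbove w r L → w < r
  LatestAbove⇒< (latest w<r) = w<r
  LatestAbove⇒< (below _ above) = LatestAbove⇒< above

  LatestAbove⇒parent : ∀ {w r L} → LatestAbove w r L → parent w L ≡ r
  LatestAbove⇒parent (latest {[]} w<r) = refl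
  LatestAbove⇒parent {w} {r} (latest {_ ∷ _} w<r) with <ᵇ-cases (toℕ w) (toℕ r)
  ... | inj₁ (e , _) rewrite e = refl
  ... | inj₂ (_ , w≮r) = ⊥-elim (w≮r w<r)
  LatestAbove⇒parent {w} {r} (below {u} {_ ∷ _} u<w above) with <ᵇ-cases (toℕ w) (toℕ u)
  ... | inj₁ (_ , w<u) = ⊥-elim (<-asym u<w w<u)
  ... | inj₂ (e , _) rewrite e | LatestAbove⇒parent above =
    i≮j⇒i⊔j≡i r u (λ r<u → <-asym (<-trans u<w (LatestAbove⇒< above)) r<u)

  parent-skip : ∀ w z L → parent w (z ∷ L) ≢ z → parent w (z ∷ L) ≡ parent w L
  parent-skip w z [] p≢z = ⊥-elim (p≢z refl)
  parent-skip w z (q ∷ Q) p≢z with toℕ w <ᵇ toℕ z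
  ... | true  = ⊥-elim (p≢z refl)
  ... | false with ⊔-sel (parent w (q ∷ Q)) z
  ...   | inj₁ e = e
  ...   | inj₂ e = ⊥-elim (p≢z e)

  -- If w's parent lies strictly behind v, then v was passed over, so v is not above w.
  parent-behind⇒≤ : ∀ Z v Y w → parent w (Z ++ v ∷ Y) ∈ Y → parent w (Z ++ v ∷ Y) ∉ v ∷ Z → v ≤ w
  parent-behind⇒≤ [] v [] w () _
  parent-behind⇒≤ [] v (q ∷ Y) w p∈ p∉ with <ᵇ-cases (toℕ w) (toℕ v)
  ... | inj₁ (e , _) rewrite e = ⊥-elim (p∉ (here refl))
  ... | inj₂ (_ , w≮v) = ℕ.≮⇒≥ w≮v
  parent-behind⇒≤ (z ∷ Z) v Y w p∈ p∉ =
    parent-behind⇒≤ Z v Y w (subst (_∈ Y) skip p∈)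
      (λ { (here e) → p∉ (here (trans skip e))
         ; (there p∈Z) → p∉ (there (there (subst (_∈ Z) (sym skip) p∈Z))) })
    where
    skip : parent w (z ∷ Z ++ v ∷ Y) ≡ parent w (Z ++ v ∷ Y)
    skip = parent-skip w z (Z ++ v ∷ Y) (λ e → p∉ (there (here e)))

  parentEdges-child∈ : ∀ {a b} L S → (a , b) ∈ parentEdges L S → a ∈ S
  parentEdges-child∈ L (v ∷ S) (here refl) = here refl
  parentEdges-child∈ L (v ∷ S) (there e∈) = there (parentEdges-child∈ (v ∷ L) S e∈)

  parentEdges-parent : ∀ {w a} L S → (w , a) ∈ parentEdges L S →
    Σ (List (Fin n)) λ Z → a ≡ parent w (Z ++ L) × All (_∈ S) Z
  parentEdges-parent L (v ∷ S) (here refl) = [] , refl , []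
  parentEdges-parent {w} L (v ∷ S) (there e∈) with parentEdges-parent (v ∷ L) S e∈
  ... | Z , a≡ , Z⊆S = Z ++ [ v ] , trans a≡ (cong (parent w) (sym (++-assoc Z [ v ] L))) ,
        ++⁺ (All.map there Z⊆S) (here refl ∷ [])

  -- u ∷ Q is the prefix read so far, most recent first, and S the rest.
  data Scan (x : Fin n) (xs : List (Fin n)) : Fin n → List (Fin n) → List (Fin n) → Set where
    start   : Scan x xs x [] xs
    advance : ∀ {u Q v S} → Scan x xs u Q (v ∷ S) → Scan x xs v (u ∷ Q) S

  record ScanInv (x : Fin n) (xs : List (Fin n)) (u : Fin n) (Q S : List (Fin n)) : Set where
    field
      split      : ∀ {z} → z ∈ x ∷ xs → z ∈ u ∷ Q ⊎ z ∈ S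
      unsplit    : ∀ {z} → z ∈ u ∷ Q ⊎ z ∈ S → z ∈ x ∷ xs
      read-uniq  : Unique (u ∷ Q)
      rest-uniq  : Unique S
      disjoint   : ∀ {z} → z ∈ u ∷ Q → z ∉ S
      edge-split : ∀ {a b} → (a , b) ∈ treeEdges (x ∷ xs) →
                   (a , b) ∈ parentEdges (u ∷ Q) S ⊎ (a ∈ u ∷ Q × b ∈ u ∷ Q)

  scan-inv : ∀ {x xs u Q S} → Unique (x ∷ xs) → Scan x xs u Q S → ScanInv x xs u Q S
  scan-inv (x∉ ∷ uniq) start = record
    { split = λ { (here e) → inj₁ (here e) ; (there z∈) → inj₂ z∈ }
    ; unsplit = λ { (inj₁ (here e)) → here e ; (inj₂ z∈) → there z∈ }
    ; read-uniq = [] ∷ []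
    ; rest-uniq = uniq
    ; disjoint = λ { (here refl) z∈ → All.lookup x∉ z∈ refl }
    ; edge-split = inj₁ }
  scan-inv {u = v} {u ∷ Q} {S} uniq (advance scan) with scan-inv uniq scan
  ... | I = record
    { split = λ z∈ → split′ (ScanInv.split I z∈)
    ; unsplit = λ z∈ → ScanInv.unsplit I (unsplit′ z∈)
    ; read-uniq = All.tabulate (λ z∈ v≡z → ScanInv.disjoint I z∈ (subst (_∈ v ∷ S) v≡z (here refl)))
                  ∷ ScanInv.read-uniq I
    ; rest-uniq = S-uniq
    ; disjoint = disjoint′
    ; edge-split = edge-split′ }
    where
    v∉S : v ∉ S
    S-uniq : Unique S
    v∉S v∈S with ScanInv.rest-uniq I
    ... | v∉ ∷ _ = All.lookup v∉ v∈S refl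
    S-uniq with ScanInv.rest-uniq I
    ... | _ ∷ uniqS = uniqS
    split′ : ∀ {z} → z ∈ u ∷ Q ⊎ z ∈ v ∷ S → z ∈ v ∷ u ∷ Q ⊎ z ∈ S
    split′ (inj₁ z∈) = inj₁ (there z∈)
    split′ (inj₂ (here e)) = inj₁ (here e)
    split′ (inj₂ (there z∈)) = inj₂ z∈
    unsplit′ : ∀ {z} → z ∈ v ∷ u ∷ Q ⊎ z ∈ S → z ∈ u ∷ Q ⊎ z ∈ v ∷ S
    unsplit′ (inj₁ (here e)) = inj₂ (here e)
    unsplit′ (inj₁ (there z∈)) = inj₁ z∈
    unsplit′ (inj₂ z∈) = inj₂ (there z∈)
    disjoint′ : ∀ {z} → z ∈ v ∷ u ∷ Q → z ∉ S
    disjoint′ (here refl) = v∉S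
    disjoint′ (there z∈) z∈S = ScanInv.disjoint I z∈ (there z∈S)
    edge-split′ : ∀ {a b} → (a , b) ∈ treeEdges _ →
                  (a , b) ∈ parentEdges (v ∷ u ∷ Q) S ⊎ (a ∈ v ∷ u ∷ Q × b ∈ v ∷ u ∷ Q)
    edge-split′ e∈ with ScanInv.edge-split I e∈
    ... | inj₁ (here refl) = inj₂ (here refl , there (parent∈ v u Q))
    ... | inj₁ (there e∈′) = inj₁ e∈′
    ... | inj₂ (a∈ , b∈) = inj₂ (there a∈ , there b∈)

  scan-parentEdges⊆ : ∀ {x xs u Q S} → Scan x xs u Q S →
    ∀ {e} → e ∈ parentEdges (u ∷ Q) S → e ∈ treeEdges (x ∷ xs)
  scan-parentEdges⊆ start e∈ = e∈
  scan-parentEdges⊆ (advance scan) e∈ = scan-parentEdges⊆ scan (there e∈)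

  run-unique : ∀ {T : Subgraph n} {u Q S} → GreedyRun T u Q S → All (_∉ u ∷ Q) S × Unique S
  run-unique (done _) = [] , []
  run-unique (next (_ , v∉ , _) _ run) with run-unique run
  ... | S∉ , uniq = v∉ ∷ All.map (λ z∉ z∈ → z∉ (there z∈)) S∉ ,
                    All.map (λ z∉ v≡z → z∉ (here (sym v≡z))) S∉ ∷ uniq

-- From decreasing subtrees to tree lists

Descent : ∀ {n} → Graph n → Fin n → Fin n → Set
Descent G a b = b < a → adj G b a

module DecreasingSubgraph {n : ℕ} (G : Graph n) (simple : IsSimple G) (T : Subgraph n)
                          (sub : IsSubgraphOf G T) (dec : IsDecreasing T) where

  edge⇒adj : ∀ {a b} → edge T a b → adj G a b
  edge⇒adj = proj₁ sub _ _

  edge⇒∈ˡ : ∀ {a b} → edge T a b → a ∈ˢ verts T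
  edge⇒∈ˡ = proj₁ (proj₂ sub) _ _

  edge-sym : ∀ {a b} → edge T a b → edge T b a
  edge-sym = proj₂ (proj₂ sub) _ _

  edge⇒∈ʳ : ∀ {a b} → edge T a b → b ∈ˢ verts T
  edge⇒∈ʳ e = edge⇒∈ˡ (edge-sym e)

  ¬edge-loop : ∀ {a} → ¬ edge T a a
  ¬edge-loop e = proj₂ simple _ (edge⇒adj e)

  upper-unique : ∀ {y a b} → edge T y a → y < a → edge T y b → y < b → a ≡ b
  upper-unique ea y<a eb y<b with dec _ (edge⇒∈ˡ ea) (_ , edge⇒∈ʳ ea , y<a)
  ... | _ , _ , _ , unique = trans (unique _ ea y<a) (sym (unique _ eb y<b))

module ListOfSubtree {n : ℕ} (G : Graph n) (simple : IsSimple G) (T : Subgraph n)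
                     (sub : IsSubgraphOf G T) (dec : IsDecreasing T) (x : Fin n) (xs : List (Fin n)) where

  open DecreasingSubgraph G simple T sub dec
  open import Data.List.Membership.DecPropositional (_≟_ {n}) using (_∈?_)

  σ : List (Fin n)
  σ = x ∷ xs

  record ReadInv (u : Fin n) (Q : List (Fin n)) : Set where
    field
      read⊆T         : ∀ {y} → y ∈ u ∷ Q → y ∈ˢ verts T
      frontier-above : ∀ {w r} → w ∉ u ∷ Q → w ∈ˢ verts T → r ∈ Q → edge T r w → u ≤ w
      upper-read     : ∀ {y} → y ∈ u ∷ Q → y ≢ maximum u Q →
                       Σ (Fin n) λ p → p ∈ u ∷ Q × edge T y p × y < p
      attach-latest  : ∀ {w r} → w ∉ u ∷ Q → w ∈ˢ verts T → r ∈ u ∷ Q → edge T r w → w < r →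
                       LatestAbove w r (u ∷ Q)
      read-edges     : ∀ {a b} → a ∈ u ∷ Q → b ∈ u ∷ Q → edge T a b → TreeEdge σ a b
  open ReadInv

  upper-unread⇒maximum : ∀ {u Q y v} → ReadInv u Q → y ∈ u ∷ Q → edge T y v → y < v → v ∉ u ∷ Q →
    y ≡ maximum u Q
  upper-unread⇒maximum {u} {Q} {y} I y∈ e y<v v∉ with y ≟ maximum u Q
  ... | yes y≡max = y≡max
  ... | no y≢max with upper-read I y∈ y≢max
  ... | p , p∈ , ep , y<p = ⊥-elim (v∉ (subst (_∈ u ∷ Q) (sym (upper-unique e y<v ep y<p)) p∈))

  read-next : ∀ {u Q v S} → ReadInv u Q → Frontier T (u ∷ Q) v → (∀ w → Frontier T (u ∷ Q) w → v ≤ w) →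
    Scan x xs u Q (v ∷ S) →
    ReadInv v (u ∷ Q) × Descent G u v × edge T v (parent v (u ∷ Q)) × (maximum u Q < v → edge T (maximum u Q) v)
  read-next {u} {Q} {v} {S} I (v∈T , v∉ , r , r∈ , erv) least scan =
    I′ , descent , proj₁ attach , proj₂ (proj₂ attach)
    where
    L = u ∷ Q
    M = maximum u Q
    A = parent v L
    A∈ : A ∈ L
    A∈ = parent∈ v u Q
    v≢M : v ≢ M
    v≢M v≡M = v∉ (subst (_∈ L) (sym v≡M) (maximum∈ u Q))
    read≢v : ∀ {y} → y ∈ L → y ≢ v
    read≢v y∈ refl = v∉ y∈

    attach : edge T v A × (∀ {y} → y ∈ L → edge T y v → y ≡ A) × (M < v → edge T M v)
    attach with <-cmp M v
    ... | tri< M<v _ _ =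
      edge-sym (subst (λ z → edge T z v) (trans r≡M (sym A≡M)) erv) , only , λ _ → subst (λ z → edge T z v) r≡M erv
      where
      A≡M : A ≡ M
      A≡M with parent-cases v u Q
      ... | inj₁ v<A = ⊥-elim (<-asym M<v (ℕ.<-≤-trans v<A (≤maximum u Q A∈)))
      ... | inj₂ (A≡M , _) = A≡M
      r≡M : r ≡ M
      r≡M = upper-unread⇒maximum I r∈ erv (ℕ.≤-<-trans (≤maximum u Q r∈) M<v) v∉
      only : ∀ {y} → y ∈ L → edge T y v → y ≡ A
      only y∈ ey = trans (upper-unread⇒maximum I y∈ ey (ℕ.≤-<-trans (≤maximum u Q y∈) M<v) v∉) (sym A≡M)
    ... | tri≈ _ M≡v _ = ⊥-elim (v≢M (sym M≡v))
    ... | tri> _ _ v<M =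
      edge-sym (subst (λ z → edge T z v) (sym A≡r) erv) , only , λ M<v → ⊥-elim (<-asym M<v v<M)
      where
      below-read : ∀ {y} → y ∈ L → edge T y v → v < y
      below-read {y} y∈ ey with <-cmp y v
      ... | tri< y<v _ _ = ⊥-elim (<-asym v<M (subst (_< v) (upper-unread⇒maximum I y∈ ey y<v v∉) y<v))
      ... | tri≈ _ y≡v _ = ⊥-elim (read≢v y∈ y≡v)
      ... | tri> _ _ v<y = v<y
      A≡r : A ≡ r
      A≡r = LatestAbove⇒parent (attach-latest I v∉ v∈T r∈ erv (below-read r∈ erv))
      only : ∀ {y} → y ∈ L → edge T y v → y ≡ A
      only y∈ ey =
        trans (upper-unique (edge-sym ey) (below-read y∈ ey) (edge-sym erv) (below-read r∈ erv)) (sym A≡r)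

    descent′ : ∀ {r} → r ∈ L → edge T r v → Descent G u v
    descent′ (here refl) er v<u = edge⇒adj (edge-sym er)
    descent′ (there r∈Q) er v<u = ⊥-elim (ℕ.<⇒≱ v<u (frontier-above I v∉ v∈T r∈Q er))
    descent : Descent G u v
    descent = descent′ r∈ erv

    parent-edge : (v , A) ∈ treeEdges σ
    parent-edge = scan-parentEdges⊆ scan (here refl)

    I′ : ReadInv v L
    read⊆T I′ (here refl) = v∈T
    read⊆T I′ (there y∈) = read⊆T I y∈
    frontier-above I′ w∉ w∈T r′∈ er′ = least _ (w∈T , (λ w∈ → w∉ (there w∈)) , _ , r′∈ , er′)
    attach-latest I′ w∉ w∈T (here refl) er′ w<r′ = latest w<r′
    attach-latest I′ {w} w∉ w∈T (there r′∈) er′ w<r′ =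
      below (≤∧≢⇒< (least w (w∈T , (λ w∈ → w∉ (there w∈)) , _ , r′∈ , er′))
                   (λ v≡w → w∉ (here (sym v≡w))))
            (attach-latest I (λ w∈ → w∉ (there w∈)) w∈T r′∈ er′ w<r′)
    read-edges I′ (here refl) (here refl) e = ⊥-elim (¬edge-loop e)
    read-edges I′ (here refl) (there b∈) e =
      inj₁ (subst (λ z → (v , z) ∈ treeEdges σ) (sym (proj₁ (proj₂ attach) b∈ (edge-sym e))) parent-edge)
    read-edges I′ (there a∈) (here refl) e =
      inj₂ (subst (λ z → (v , z) ∈ treeEdges σ) (sym (proj₁ (proj₂ attach) a∈ e)) parent-edge)
    read-edges I′ (there a∈) (there b∈) e = read-edges I a∈ b∈ e
    upper-read I′ {y} y∈ y≢ with <-cmp M v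
    upper-read I′ {y} (here refl) y≢ | tri< M<v _ _ = ⊥-elim (y≢ (sym (i<j⇒i⊔j≡j M v M<v)))
    upper-read I′ {y} (there y∈) y≢ | tri< M<v _ _ with y ≟ M
    ... | yes refl = v , here refl , proj₂ (proj₂ attach) M<v , M<v
    ... | no y≢M with upper-read I y∈ y≢M
    ...   | p , p∈ , ep , y<p = p , there p∈ , ep , y<p
    upper-read I′ {y} y∈ y≢ | tri≈ _ M≡v _ = ⊥-elim (v≢M (sym M≡v))
    upper-read I′ {y} (here refl) y≢ | tri> _ _ v<M with parent-cases v u Q
    ... | inj₁ v<A = A , there A∈ , proj₁ attach , v<A
    ... | inj₂ (A≡M , _) = A , there A∈ , proj₁ attach , subst (v <_) (sym A≡M) v<M
    upper-read I′ {y} (there y∈) y≢ | tri> _ _ v<M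
      with upper-read I y∈ (λ y≡M → y≢ (trans y≡M (sym (i≮j⇒i⊔j≡i M v (λ M<v → <-asym M<v v<M)))))
    ... | p , p∈ , ep , y<p = p , there p∈ , ep , y<p

  walk-stays-in : ∀ {a z} L → (∀ w → ¬ Frontier T L w) → Walk T a z → a ∈ L → z ∈ L
  walk-stays-in L closed (here _) a∈ = a∈
  walk-stays-in L closed (step {w = w} e walk) a∈ with w ∈? L
  ... | yes w∈ = walk-stays-in L closed walk w∈
  ... | no w∉ = ⊥-elim (closed w (edge⇒∈ʳ e , w∉ , _ , a∈ , e))

  record Outcome (u : Fin n) (Q S : List (Fin n)) : Set where
    field
      descents     : Linked (Descent G) (u ∷ S)
      maxima       : Linked (adj G) (maximum u Q ∷ ltrFrom (maximum u Q) S)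
      parent-edges : ∀ {a b} → (a , b) ∈ parentEdges (u ∷ Q) S → edge T a b
      edge⇒tree-edge   : ∀ {a b} → a ∈ σ → b ∈ σ → edge T a b → TreeEdge σ a b
      T⊆σ          : ∀ {z} → z ∈ˢ verts T → z ∈ σ
      σ⊆T          : ∀ {z} → z ∈ σ → z ∈ˢ verts T

  module _ (connected : Connected T) (uniq : Unique σ) (x∈T : x ∈ˢ verts T) where

    scan-run : ∀ {u Q S} → GreedyRun T u Q S → Scan x xs u Q S → ReadInv u Q → Outcome u Q S
    scan-run {u} {Q} (done closed) scan I = record
      { descents = [-] ; maxima = [-] ; parent-edges = λ ()
      ; edge⇒tree-edge = λ a∈ b∈ e → read-edges I (σ⊆read a∈) (σ⊆read b∈) e
      ; T⊆σ = λ {z} z∈T → ScanInv.unsplit inv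
                (inj₁ (walk-stays-in (u ∷ Q) closed (connected x z x∈T z∈T) (σ⊆read (here refl))))
      ; σ⊆T = λ z∈ → read⊆T I (σ⊆read z∈) }
      where
      inv : ScanInv x xs u Q []
      inv = scan-inv uniq scan
      σ⊆read : ∀ {z} → z ∈ σ → z ∈ u ∷ Q
      σ⊆read z∈ with ScanInv.split inv z∈
      ... | inj₁ z∈read = z∈read
    scan-run {u} {Q} {v ∷ S} (next fv least run) scan I with read-next I fv least scan
    ... | I′ , descent , e-parent , e-max with scan-run run (advance scan) I′
    ... | O = record
      { descents = descent ∷ Outcome.descents O
      ; maxima = ltrFrom-∷⁺ {S = S} (λ M<v → edge⇒adj (e-max M<v)) (Outcome.maxima O)
      ; parent-edges = parent-edges′
      ; edge⇒tree-edge = Outcome.edge⇒tree-edge O ; T⊆σ = Outcome.T⊆σ O ; σ⊆T = Outcome.σ⊆T O }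
      where
      parent-edges′ : ∀ {a b} → (a , b) ∈ parentEdges (u ∷ Q) (v ∷ S) → edge T a b
      parent-edges′ (here refl) = e-parent
      parent-edges′ (there e∈) = Outcome.parent-edges O e∈

    read-start : ReadInv x []
    read⊆T read-start (here refl) = x∈T
    frontier-above read-start _ _ () _
    upper-read read-start (here refl) y≢ = ⊥-elim (y≢ refl)
    attach-latest read-start _ _ (here refl) _ w<r = latest w<r
    read-edges read-start (here refl) (here refl) e = ⊥-elim (¬edge-loop e)

    list-outcome : GreedyRun T x [] xs → Outcome x [] xs
    list-outcome run = scan-run run start read-start

-- Walks and acyclicity

module _ {n : ℕ} {T : Subgraph n} where

  walk-++ : ∀ {a b c} → Walk T a b → Walk T b c → Walk T a c
  walk-++ (here _) w = w
  walk-++ (step e w₁) w₂ = step e (walk-++ w₁ w₂)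

  walk-reverse : ∀ (G : Graph n) → IsSubgraphOf G T → ∀ {a b} → Walk T a b → Walk T b a
  walk-reverse G sub (here a∈) = here a∈
  walk-reverse G sub (step {u} {w} e walk) =
    walk-++ (walk-reverse G sub walk) (step (proj₂ (proj₂ sub) u w e) (here (proj₁ (proj₂ sub) u w e)))

¬Linked-cycle : ∀ {A : Set} {R : A → A → Set} → Transitive R → Irreflexive _≡_ R →
  ∀ a b M → ¬ Linked R (a ∷ b ∷ M ++ [ a ])
¬Linked-cycle tr irr a b M (r ∷ linked) =
  irr refl (All.lookup (Linked⇒All tr r linked) (there (∈-++⁺ʳ M (here refl))))

module _ {n : ℕ} where

  NonBacktracking : Fin n → Fin n → List (Fin n) → Set
  NonBacktracking a b [] = ⊤
  NonBacktracking a b (c ∷ L) = a ≢ c × NonBacktracking b c L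

  unique⇒nonBacktracking : ∀ b m M a → Unique (b ∷ m ∷ M) → a ∉ b ∷ m ∷ M →
    NonBacktracking b m (M ++ [ a ])
  unique⇒nonBacktracking b m [] a _ a∉ = (λ b≡a → a∉ (here (sym b≡a))) , tt
  unique⇒nonBacktracking b m (m′ ∷ M) a (b∉ ∷ uniq) a∉ =
    All.lookup b∉ (there (here refl)) , unique⇒nonBacktracking m m′ M a uniq (λ a∈ → a∉ (there a∈))

  cycle-nonBacktracking : ∀ x y₁ y₂ ys → Unique (x ∷ y₁ ∷ y₂ ∷ ys) →
    NonBacktracking x y₁ (y₂ ∷ ys ++ [ x ])
  cycle-nonBacktracking x y₁ y₂ ys (x∉ ∷ uniq) =
    All.lookup x∉ (there (here refl)) ,
    unique⇒nonBacktracking y₁ y₂ ys x uniq (λ x∈ → All.lookup x∉ x∈ refl)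

  lastOf : Fin n → List (Fin n) → Fin n
  lastOf y [] = y
  lastOf y (m ∷ M) = lastOf m M

  lastOf∈ : ∀ m M → lastOf m M ∈ m ∷ M
  lastOf∈ m [] = here refl
  lastOf∈ m (m′ ∷ M) = there (lastOf∈ m′ M)

module Acyclic {n : ℕ} (G : Graph n) (simple : IsSimple G) (T : Subgraph n)
               (sub : IsSubgraphOf G T) (dec : IsDecreasing T) where

  open DecreasingSubgraph G simple T sub dec

  other-neighbour-below : ∀ {z₀ z₁ z₂} → edge T z₁ z₀ → edge T z₁ z₂ → z₀ ≢ z₂ → z₁ < z₂ → z₀ < z₁
  other-neighbour-below {z₀} {z₁} e₁₀ e₁₂ z₀≢z₂ z₁<z₂ with <-cmp z₀ z₁
  ... | tri< z₀<z₁ _ _ = z₀<z₁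
  ... | tri≈ _ refl _ = ⊥-elim (¬edge-loop e₁₀)
  ... | tri> _ _ z₁<z₀ = ⊥-elim (z₀≢z₂ (upper-unique e₁₀ z₁<z₀ e₁₂ z₁<z₂))

  descending : ∀ z₀ z₁ L → Linked (edge T) (z₀ ∷ z₁ ∷ L) → NonBacktracking z₀ z₁ L → z₁ < z₀ →
    Linked (flip _<_) (z₀ ∷ z₁ ∷ L)
  descending z₀ z₁ [] _ _ z₁<z₀ = z₁<z₀ ∷ [-]
  descending z₀ z₁ (z₂ ∷ L) (e₀₁ ∷ e₁₂ ∷ linked) (z₀≢z₂ , nb) z₁<z₀ =
    z₁<z₀ ∷ descending z₁ z₂ L (e₁₂ ∷ linked) nb
              (other-neighbour-below e₁₂ (edge-sym e₀₁) (λ z₂≡z₀ → z₀≢z₂ (sym z₂≡z₀)) z₁<z₀)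

  ascending : ∀ z₀ z₁ M c → Linked (edge T) (z₀ ∷ z₁ ∷ M ++ [ c ]) →
    NonBacktracking z₀ z₁ (M ++ [ c ]) →
    lastOf z₁ M < c → Linked _<_ (z₀ ∷ z₁ ∷ M ++ [ c ])
  ascending z₀ z₁ [] c (e₀₁ ∷ e₁c ∷ _) (z₀≢c , _) z₁<c =
    other-neighbour-below (edge-sym e₀₁) e₁c z₀≢c z₁<c ∷ z₁<c ∷ [-]
  ascending z₀ z₁ (m ∷ M) c (e₀₁ ∷ linked@(e₁m ∷ _)) (z₀≢m , nb) last<c
    with ascending z₁ m M c linked nb last<c
  ... | z₁<m ∷ rest = other-neighbour-below (edge-sym e₀₁) e₁m z₀≢m z₁<m ∷ z₁<m ∷ rest

  last-edge : ∀ a b M c → Linked (edge T) (a ∷ b ∷ M ++ [ c ]) → edge T (lastOf b M) c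
  last-edge a b [] c (_ ∷ e ∷ _) = e
  last-edge a b (m ∷ M) c (_ ∷ linked) = last-edge b m M c linked

  -- Along a cycle through x the walk out of x either starts downwards, or ends
  -- downwards into x (x cannot have two larger neighbours); both force a monotone cycle.
  acyclic : ¬ HasCycle T
  acyclic (x , [] , () , _)
  acyclic (x , _ ∷ [] , s≤s () , _)
  acyclic (x , y₁ ∷ y₂ ∷ ys , _ , uniq@(x∉ ∷ y₁∉ ∷ _) , cycle@(e₀₁ ∷ _)) with <-cmp x y₁
  ... | tri≈ _ x≡y₁ _ = All.lookup x∉ (here refl) x≡y₁
  ... | tri> _ _ y₁<x =
    ¬Linked-cycle {R = flip _<_} (λ j<i k<j → <-trans k<j j<i) (λ i≡j j<i → <-irrefl (sym i≡j) j<i)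
      x y₁ (y₂ ∷ ys)
      (descending x y₁ (y₂ ∷ ys ++ [ x ]) cycle (cycle-nonBacktracking x y₁ y₂ ys uniq) y₁<x)
  ... | tri< x<y₁ _ _ with <-cmp x (lastOf y₂ ys)
  ...   | tri< x<yₖ _ _ = All.lookup y₁∉ (lastOf∈ y₂ ys)
                            (upper-unique e₀₁ x<y₁ (edge-sym (last-edge x y₁ (y₂ ∷ ys) x cycle)) x<yₖ)
  ...   | tri≈ _ x≡yₖ _ = All.lookup x∉ (there (lastOf∈ y₂ ys)) x≡yₖ
  ...   | tri> _ _ yₖ<x = ¬Linked-cycle <-trans <-irrefl x y₁ (y₂ ∷ ys)
                            (ascending x y₁ (y₂ ∷ ys) x cycle (cycle-nonBacktracking x y₁ y₂ ys uniq) yₖ<x)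

-- From tree lists to decreasing subtrees

module _ {n : ℕ} (σ : List (Fin n)) where

  open import Data.List.Membership.DecPropositional (_≟_ {n}) using (_∈?_)
  open import Data.List.Membership.DecPropositional (≡-dec (_≟_ {n}) (_≟_ {n})) using ()
    renaming (_∈?_ to _∈?ₑ_)

  treeOf : Subgraph n
  treeOf = mkSub (V.tabulate λ z → does (z ∈? σ))
                 (V.tabulate λ a → V.tabulate λ b →
                    does ((a , b) ∈?ₑ treeEdges σ) ∨ does ((b , a) ∈?ₑ treeEdges σ))

  ∈-treeOf⁺ : ∀ {z} → z ∈ σ → z ∈ˢ verts treeOf
  ∈-treeOf⁺ {z} z∈ = lookup⇒∈ˢ (verts treeOf) z (trans (lookup∘tabulate _ z) (dec-true (z ∈? σ) z∈))

  ∈-treeOf⁻ : ∀ {z} → z ∈ˢ verts treeOf → z ∈ σ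
  ∈-treeOf⁻ {z} z∈ with z ∈? σ | trans (sym (lookup∘tabulate _ z)) (∈ˢ⇒lookup (verts treeOf) z∈)
  ... | yes z∈σ | _ = z∈σ

  private
    edgeᵇ-treeOf : ∀ a b → lookup (lookup (edges treeOf) a) b ≡
                   does ((a , b) ∈?ₑ treeEdges σ) ∨ does ((b , a) ∈?ₑ treeEdges σ)
    edgeᵇ-treeOf a b = trans (cong (λ r → lookup r b) (lookup∘tabulate _ a)) (lookup∘tabulate _ b)

  edge-treeOf⁺ : ∀ {a b} → TreeEdge σ a b → edge treeOf a b
  edge-treeOf⁺ {a} {b} (inj₁ ab∈) rewrite edgeᵇ-treeOf a b | dec-true ((a , b) ∈?ₑ treeEdges σ) ab∈ = refl
  edge-treeOf⁺ {a} {b} (inj₂ ba∈) rewrite edgeᵇ-treeOf a b | dec-true ((b , a) ∈?ₑ treeEdges σ) ba∈ =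
    ∨-zeroʳ _

  edge-treeOf⁻ : ∀ {a b} → edge treeOf a b → TreeEdge σ a b
  edge-treeOf⁻ {a} {b} e
    with (a , b) ∈?ₑ treeEdges σ | (b , a) ∈?ₑ treeEdges σ | trans (sym (edgeᵇ-treeOf a b)) e
  ... | yes ab∈ | _ | _ = inj₁ ab∈
  ... | no _ | yes ba∈ | _ = inj₂ ba∈

module SubtreeOfList {n : ℕ} (G : Graph n) (simple : IsSimple G) (nui : IsNUI G) (x : Fin n) (xs : List (Fin n))
                     (treeList : IsTreeList G (x ∷ xs)) where

  σ : List (Fin n)
  σ = x ∷ xs

  uniq : Unique σ
  uniq = proj₁ (proj₂ treeList)

  -- The natural unit interval property enters here: from u < v < q and u ~ q it
  -- gives v ~ q, so adjacency to v passes back through the entries read after v's parent.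
  parent-adj : ∀ v u Q → Linked (flip (Descent G)) (u ∷ Q) → Descent G u v → v < parent v (u ∷ Q) →
    adj G v (parent v (u ∷ Q))
  parent-adj v u [] _ descent v<p = descent v<p
  parent-adj v u (q ∷ Q) (descent-uq ∷ linked) descent v<p with <ᵇ-cases (toℕ v) (toℕ u)
  ... | inj₁ (e , v<u) rewrite e = descent v<u
  ... | inj₂ (e , v≮u) rewrite e with ⊔-sel (parent v (q ∷ Q)) u
  ...   | inj₂ p≡u rewrite p≡u = ⊥-elim (v≮u v<p)
  ...   | inj₁ p≡ rewrite p≡ = parent-adj v q Q linked descent-qv v<p
    where
    descent-qv : Descent G q v
    descent-qv v<q with <-cmp u v
    ... | tri< u<v _ _ = proj₂ (nui u v q u<v v<q (descent-uq (<-trans u<v v<q)))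
    ... | tri≈ _ refl _ = descent-uq v<q
    ... | tri> _ _ v<u = ⊥-elim (v≮u v<u)

  UniqueUpper : List (Fin n) → Fin n → Set
  UniqueUpper L y = Σ (Fin n) λ p → p ∈ L × TreeEdge σ y p × y < p ×
                    (∀ {q} → q ∈ L → TreeEdge σ y q → y < q → q ≡ p)

  record BuildInv (u : Fin n) (Q S : List (Fin n)) : Set where
    field
      walk-to-root  : ∀ {y} → y ∈ u ∷ Q → Walk (treeOf σ) y x
      unique-upper  : ∀ {y} → y ∈ u ∷ Q → y ≢ maximum u Q → UniqueUpper (u ∷ Q) y
      read-descents : Linked (flip (Descent G)) (u ∷ Q)
      rest-descents : Linked (Descent G) (u ∷ S)
      rest-maxima   : Linked (adj G) (maximum u Q ∷ ltrFrom (maximum u Q) S)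
  open BuildInv

  module Advance {u Q v S} (scan : Scan x xs u Q (v ∷ S)) where

    inv : ScanInv x xs u Q (v ∷ S)
    inv = scan-inv uniq scan

    L = u ∷ Q
    M = maximum u Q
    A = parent v L

    v∉L : v ∉ L
    v∉L v∈L = ScanInv.disjoint inv v∈L (here refl)

    v∉S : v ∉ S
    v∉S v∈S with ScanInv.rest-uniq inv
    ... | v∉ ∷ _ = All.lookup v∉ v∈S refl

    A∈ : A ∈ L
    A∈ = parent∈ v u Q

    parent-edge : (v , A) ∈ treeEdges σ
    parent-edge = scan-parentEdges⊆ scan (here refl)

    tree-edge⇒parent : ∀ {y} → y ∈ L → TreeEdge σ y v → y ≡ A
    tree-edge⇒parent y∈ (inj₁ yv∈) with ScanInv.edge-split inv yv∈
    ... | inj₁ yv∈′ = ⊥-elim (ScanInv.disjoint inv y∈ (parentEdges-child∈ L (v ∷ S) yv∈′))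
    ... | inj₂ (_ , v∈L) = ⊥-elim (v∉L v∈L)
    tree-edge⇒parent y∈ (inj₂ vy∈) with ScanInv.edge-split inv vy∈
    ... | inj₁ (here refl) = refl
    ... | inj₁ (there vy∈′) = ⊥-elim (v∉S (parentEdges-child∈ (v ∷ L) S vy∈′))
    ... | inj₂ (v∈L , _) = ⊥-elim (v∉L v∈L)

    frontier-least : ∀ {w r} → w ∉ L → r ∈ L → TreeEdge σ r w → v ≤ w
    frontier-least w∉ r∈ (inj₁ rw∈) with ScanInv.edge-split inv rw∈
    ... | inj₁ rw∈′ = ⊥-elim (ScanInv.disjoint inv r∈ (parentEdges-child∈ L (v ∷ S) rw∈′))
    ... | inj₂ (_ , w∈L) = ⊥-elim (w∉ w∈L)
    frontier-least {w} w∉ r∈ (inj₂ wr∈) with ScanInv.edge-split inv wr∈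
    ... | inj₂ (w∈L , _) = ⊥-elim (w∉ w∈L)
    ... | inj₁ (here refl) = ≤-refl
    ... | inj₁ (there wr∈′) with parentEdges-parent (v ∷ L) S wr∈′
    ...   | Z , r≡ , Z⊆S = parent-behind⇒≤ Z v L w (subst (_∈ L) r≡ r∈) not-recent
      where
      not-recent : parent w (Z ++ v ∷ L) ∉ v ∷ Z
      not-recent (here p≡v) = v∉L (subst (_∈ L) (trans r≡ p≡v) r∈)
      not-recent (there p∈Z) = ScanInv.disjoint inv r∈ (there (All.lookup Z⊆S (subst (_∈ Z) (sym r≡) p∈Z)))

    unique-upper-next : (∀ {y} → y ∈ L → y ≢ M → UniqueUpper L y) →
      ∀ {y} → y ∈ v ∷ L → y ≢ maximum v L → UniqueUpper (v ∷ L) y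
    unique-upper-next old y∈ y≢ with parent-cases v u Q
    unique-upper-next old (here refl) y≢ | inj₁ v<A =
      A , there A∈ , inj₁ parent-edge , v<A ,
      λ { (here refl) _ v<v → ⊥-elim (<-irrefl refl v<v)
        ; (there q∈) te _ → tree-edge⇒parent q∈ (TreeEdge-sym te) }
    unique-upper-next old (there y∈) y≢ | inj₁ v<A
      with old y∈ (λ y≡M → y≢ (trans y≡M (sym (i≮j⇒i⊔j≡i M v
                     (λ M<v → <-asym M<v (ℕ.<-≤-trans v<A (≤maximum u Q A∈)))))))
    ... | p , p∈ , te , y<p , unique = p , there p∈ , te , y<p ,
      λ { (here refl) te′ y<v → ⊥-elim (<-asym y<v (subst (v <_) (sym (tree-edge⇒parent y∈ te′)) v<A))
        ; (there q∈) te′ y<q → unique q∈ te′ y<q }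
    unique-upper-next old y∈ y≢ | inj₂ (A≡M , M≤v)
      with ≤∧≢⇒< M≤v (λ M≡v → v∉L (subst (_∈ L) M≡v (maximum∈ u Q)))
    unique-upper-next old (here refl) y≢ | inj₂ _ | M<v = ⊥-elim (y≢ (sym (i<j⇒i⊔j≡j M v M<v)))
    unique-upper-next old {y} (there y∈) y≢ | inj₂ (A≡M , _) | M<v with y ≟ M
    ... | yes refl = v , here refl , inj₂ (subst (λ z → (v , z) ∈ treeEdges σ) A≡M parent-edge) , M<v ,
      λ { (here refl) _ _ → refl ; (there q∈) _ y<q → ⊥-elim (ℕ.<⇒≱ y<q (≤maximum u Q q∈)) }
    ... | no y≢M with old y∈ y≢M
    ...   | p , p∈ , te , y<p , unique = p , there p∈ , te , y<p ,
      λ { (here refl) te′ _ → ⊥-elim (y≢M (trans (tree-edge⇒parent y∈ te′) A≡M))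
        ; (there q∈) te′ y<q → unique q∈ te′ y<q }

    build-next : BuildInv u Q (v ∷ S) → BuildInv v L S
    walk-to-root (build-next I) (here refl) = step (edge-treeOf⁺ σ (inj₁ parent-edge)) (walk-to-root I A∈)
    walk-to-root (build-next I) (there y∈) = walk-to-root I y∈
    unique-upper (build-next I) = unique-upper-next (unique-upper I)
    read-descents (build-next I) = head (rest-descents I) ∷ read-descents I
    rest-descents (build-next I) = tail (rest-descents I)
    rest-maxima (build-next I) = ltrFrom-∷⁻ {v = v} {S = S} (rest-maxima I)

    parent-adjacent : BuildInv u Q (v ∷ S) → adj G v A
    parent-adjacent I with parent-cases v u Q
    ... | inj₁ v<A = parent-adj v u Q (read-descents I) (head (rest-descents I)) v<A
    ... | inj₂ (A≡M , M≤v) =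
      subst (adj G v) (sym A≡M) (proj₁ simple M v (ltrFrom-head {S = S} M<v (rest-maxima I)))
      where
      M<v : M < v
      M<v = ≤∧≢⇒< M≤v (λ M≡v → v∉L (subst (_∈ L) M≡v (maximum∈ u Q)))

  record Outcome (u : Fin n) (Q S : List (Fin n)) : Set where
    field
      run          : GreedyRun (treeOf σ) u Q S
      parent-edges-adj : ∀ {a b} → (a , b) ∈ parentEdges (u ∷ Q) S → adj G a b
      walks        : ∀ {y} → y ∈ σ → Walk (treeOf σ) y x
      uppers       : ∀ {y w} → y ∈ σ → w ∈ σ → y < w → UniqueUpper σ y
      tree-edge⇒∈       : ∀ {a b} → TreeEdge σ a b → a ∈ σ

  build : ∀ {u Q S} → Scan x xs u Q S → BuildInv u Q S → Outcome u Q S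
  build {u} {Q} {[]} scan I = record
    { run = done λ w (w∈T , w∉ , _) → w∉ (σ⊆read (∈-treeOf⁻ σ w∈T))
    ; parent-edges-adj = λ ()
    ; walks = λ y∈ → walk-to-root I (σ⊆read y∈)
    ; uppers = uppers
    ; tree-edge⇒∈ = λ { (inj₁ ab∈) → proj₁ (ends ab∈) ; (inj₂ ba∈) → proj₂ (ends ba∈) } }
    where
    inv : ScanInv x xs u Q []
    inv = scan-inv uniq scan
    σ⊆read : ∀ {z} → z ∈ σ → z ∈ u ∷ Q
    σ⊆read z∈ with ScanInv.split inv z∈
    ... | inj₁ z∈read = z∈read
    uppers : ∀ {y w} → y ∈ σ → w ∈ σ → y < w → UniqueUpper σ y
    uppers {y} {w} y∈ w∈ y<w
      with unique-upper I (σ⊆read y∈) (λ y≡M → ℕ.<⇒≱ (subst (_< w) y≡M y<w) (≤maximum u Q (σ⊆read w∈)))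
    ... | p , p∈ , te , y<p , unique =
      p , ScanInv.unsplit inv (inj₁ p∈) , te , y<p , λ q∈ → unique (σ⊆read q∈)
    ends : ∀ {a b} → (a , b) ∈ treeEdges σ → a ∈ σ × b ∈ σ
    ends ab∈ with ScanInv.edge-split inv ab∈
    ... | inj₂ (a∈ , b∈) = ScanInv.unsplit inv (inj₁ a∈) , ScanInv.unsplit inv (inj₁ b∈)
  build {u} {Q} {v ∷ S} scan I with build (advance scan) (build-next I)
    where open Advance scan
  ... | O = record
    { run = next (∈-treeOf⁺ σ (ScanInv.unsplit inv (inj₂ (here refl))) , v∉L , A , A∈ ,
                  edge-treeOf⁺ σ (inj₂ parent-edge))
                 (λ w (_ , w∉ , _ , r∈ , e) → frontier-least w∉ r∈ (edge-treeOf⁻ σ e))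
                 (Outcome.run O)
    ; parent-edges-adj = λ { (here refl) → parent-adjacent I ; (there e∈) → Outcome.parent-edges-adj O e∈ }
    ; walks = Outcome.walks O
    ; uppers = Outcome.uppers O
    ; tree-edge⇒∈ = Outcome.tree-edge⇒∈ O }
    where open Advance scan

  build-start : BuildInv x [] xs
  walk-to-root build-start (here refl) = here (∈-treeOf⁺ σ (here refl))
  unique-upper build-start (here refl) y≢ = ⊥-elim (y≢ refl)
  read-descents build-start = [-]
  rest-descents build-start = proj₁ (proj₂ (proj₂ treeList))
  rest-maxima build-start = proj₂ (proj₂ (proj₂ treeList))

module _ {n : ℕ} where

  private
    bool-ext : ∀ {b b′ : Bool} → (b ≡ true ⇔ b′ ≡ true) → b ≡ b′
    bool-ext {true} b⇔b′ = sym (Equivalence.to b⇔b′ refl)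
    bool-ext {false} {true} b⇔b′ = Equivalence.from b⇔b′ refl
    bool-ext {false} {false} _ = refl

    vec-ext : ∀ {A : Set} {m} (v w : Vec A m) → (∀ i → lookup v i ≡ lookup w i) → v ≡ w
    vec-ext v w v≗w = trans (sym (tabulate∘lookup v)) (trans (tabulate-cong v≗w) (tabulate∘lookup w))

  Subgraph-ext : ∀ {T T′ : Subgraph n} → (∀ z → z ∈ˢ verts T ⇔ z ∈ˢ verts T′) →
    (∀ a b → edge T a b ⇔ edge T′ a b) → T ≡ T′
  Subgraph-ext {T} {T′} verts⇔ edges⇔ = cong₂ mkSub
    (vec-ext _ _ λ z → bool-ext (mk⇔ (λ t → ∈ˢ⇒lookup _ (Equivalence.to (verts⇔ z) (lookup⇒∈ˢ _ z t)))
                                     (λ t → ∈ˢ⇒lookup _ (Equivalence.from (verts⇔ z) (lookup⇒∈ˢ _ z t)))))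
    (vec-ext _ _ λ a → vec-ext _ _ λ b → bool-ext (edges⇔ a b))

  listT-root : ∀ (T : Subgraph n) {x} → firstWith (lookup (verts T)) (allFin n) ≡ just x →
    listT T ≡ grow T n [ x ]
  listT-root T eq rewrite eq = refl

module Bijection {n : ℕ} (G : Graph n) (simple : IsSimple G) where

  record Listing (T : Subgraph n) (sub : IsSubgraphOf G T) (dec : IsDecreasing T) : Set where
    field
      root       : Fin n
      rest       : List (Fin n)
      listT≡     : listT T ≡ root ∷ rest
      root-least : ∀ {w} → w ∈ˢ verts T → root ≤ w
      unique     : Unique (root ∷ rest)
      outcome    : ListOfSubtree.Outcome G simple T sub dec root rest root [] rest

  listing : ∀ T → (dt : IsDecSubtree G T) → Listing T (proj₁ dt) (proj₂ (proj₂ dt))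
  listing T (sub , ((v , v∈T) , connected , _) , dec) with firstWith (lookup (verts T)) (allFin n) in eq
  ... | nothing = ⊥-elim (true≢false (trans (sym (∈ˢ⇒lookup (verts T) v∈T)) (firstWith-nothing⇒none _ eq v)))
  ... | just x with firstWith-just⇒least (lookup (verts T)) x eq
  ...   | x∈T , least with grow⇒run T n [ x ] x [] (λ z∈ → z∈) (λ z∈ → z∈) ([] ∷ []) ℕ.≤-refl
  ...     | S , grow≡ , run = record
    { root = x ; rest = S ; listT≡ = trans (listT-root T eq) grow≡
    ; root-least = λ w∈ → least _ (∈ˢ⇒lookup (verts T) w∈)
    ; unique = unique
    ; outcome = ListOfSubtree.list-outcome G simple T sub dec x S connected unique (lookup⇒∈ˢ (verts T) x x∈T) run }
    where
    unique : Unique (x ∷ S)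
    unique with run-unique run
    ... | S∉ , uniqS = All.map (λ z∉ x≡z → z∉ (here (sym x≡z))) S∉ ∷ uniqS

  listT-treeList : ∀ T → IsDecSubtree G T → IsTreeList G (listT T)
  listT-treeList T dt with listing T dt
  ... | record { root = x ; rest = S ; listT≡ = listT≡ ; root-least = least
               ; unique = unique@(x∉ ∷ _) ; outcome = O } rewrite listT≡ =
    All.tabulate (λ s∈ → ≤∧≢⇒< (least (σ⊆T (there s∈))) (All.lookup x∉ s∈)) , unique , descents , maxima
    where open ListOfSubtree.Outcome O

  listT-determines : ∀ T → IsDecSubtree G T → ∀ {σ} → listT T ≡ σ →
    (∀ z → z ∈ˢ verts T ⇔ z ∈ σ) × (∀ a b → edge T a b ⇔ TreeEdge σ a b)
  listT-determines T dt@(sub , _ , dec) refl with listing T dt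
  ... | record { root = x ; rest = S ; listT≡ = listT≡ ; outcome = O } rewrite listT≡ =
    (λ z → mk⇔ T⊆σ σ⊆T) ,
    (λ a b → mk⇔ (λ e → edge⇒tree-edge (T⊆σ (edge⇒∈ˡ e)) (T⊆σ (edge⇒∈ʳ e)) e)
                 λ { (inj₁ ab∈) → parent-edges ab∈ ; (inj₂ ba∈) → edge-sym (parent-edges ba∈) })
    where
    open ListOfSubtree.Outcome O
    open DecreasingSubgraph G simple T sub dec

  listT-injective : ∀ T T′ → IsDecSubtree G T → IsDecSubtree G T′ → listT T ≡ listT T′ → T ≡ T′
  listT-injective T T′ dt dt′ eq with listT-determines T dt eq | listT-determines T′ dt′ refl
  ... | verts⇔ , edges⇔ | verts⇔′ , edges⇔′ =
    Subgraph-ext (λ z → ⇔-trans (verts⇔ z) (⇔-sym (verts⇔′ z)))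
                 (λ a b → ⇔-trans (edges⇔ a b) (⇔-sym (edges⇔′ a b)))

  treeOf-decSubtree : IsNUI G → ∀ σ → IsTreeList G σ → IsDecSubtree G (treeOf σ) × listT (treeOf σ) ≡ σ
  treeOf-decSubtree nui (x ∷ xs) treeList@(x<xs , _) =
    (sub , ((x , ∈-treeOf⁺ σ (here refl)) , connected , Acyclic.acyclic G simple (treeOf σ) sub dec) , dec) ,
    trans (listT-root (treeOf σ) first)
          (grow-run (treeOf σ) (Outcome.run O) n [ x ] (λ z∈ → z∈) (λ z∈ → z∈)
                    (ℕ.≤-trans (ℕ.n≤1+n _) (length≤n σ uniq)))
    where
    open SubtreeOfList G simple nui x xs treeList
    O : Outcome x [] xs
    O = build start build-start
    tree-edge⇒adj : ∀ {a b} → TreeEdge σ a b → adj G a b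
    tree-edge⇒adj (inj₁ ab∈) = Outcome.parent-edges-adj O ab∈
    tree-edge⇒adj (inj₂ ba∈) = proj₁ simple _ _ (Outcome.parent-edges-adj O ba∈)
    sub : IsSubgraphOf G (treeOf σ)
    sub = (λ a b e → tree-edge⇒adj (edge-treeOf⁻ σ e)) ,
          (λ a b e → ∈-treeOf⁺ σ (Outcome.tree-edge⇒∈ O (edge-treeOf⁻ σ e))) ,
          (λ a b e → edge-treeOf⁺ σ (TreeEdge-sym (edge-treeOf⁻ σ e)))
    dec : IsDecreasing (treeOf σ)
    dec v v∈ (w , w∈ , v<w) with Outcome.uppers O (∈-treeOf⁻ σ v∈) (∈-treeOf⁻ σ w∈) v<w
    ... | p , _ , te , v<p , unique = p , edge-treeOf⁺ σ te , v<p ,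
          λ w e v<w → unique (Outcome.tree-edge⇒∈ O (TreeEdge-sym (edge-treeOf⁻ σ e))) (edge-treeOf⁻ σ e) v<w
    connected : Connected (treeOf σ)
    connected a b a∈ b∈ =
      walk-++ (Outcome.walks O (∈-treeOf⁻ σ a∈)) (walk-reverse G sub (Outcome.walks O (∈-treeOf⁻ σ b∈)))
    first : firstWith (lookup (verts (treeOf σ))) (allFin n) ≡ just x
    first = least⇒firstWith-just _ x (∈ˢ⇒lookup _ (∈-treeOf⁺ σ (here refl))) least
      where
      least : ∀ w → lookup (verts (treeOf σ)) w ≡ true → x ≤ w
      least w t with ∈-treeOf⁻ σ (lookup⇒∈ˢ _ w t)
      ... | here refl = ≤-refl
      ... | there w∈ = ℕ.<⇒≤ (All.lookup x<xs w∈)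

lemma3p11 : ∀ {n : ℕ} (G : Graph n) → IsSimple G → IsNUI G →
    ((T : Subgraph n) → IsDecSubtree G T → IsTreeList G (listT T)) ×
    ((T T′ : Subgraph n) → IsDecSubtree G T → IsDecSubtree G T′ → listT T ≡ listT T′ → T ≡ T′) ×
    (∀ σ → IsTreeList G σ → Σ (Subgraph n) λ T → IsDecSubtree G T × listT T ≡ σ)
lemma3p11 G simple nui =
  listT-treeList , listT-injective , λ σ treeList → treeOf σ , treeOf-decSubtree nui σ treeList
  where open Bijection G simple
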